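{- Let $p$ be an odd prime and let $P,Q$ be rationals with denominators not divisible by $p$ such that $p\nmid PQ(P^2-4Q)$ and $\big(\frac Qp\big)=1$. (i) If $\big(\frac{4Q-P^2}p\big)=-1$, then $\sum_{k=0}^{[p/4]}\binom{4k}{2k}\big(\frac{P^2}{64Q}\big)^k\equiv0\pmod p$. (ii) If $\big(\frac{P^2-4Q}p\big)=-1$, then $\sum_{k=0}^{[p/4]}\binom{4k}{2k}\big(\frac{Q}{4P^2}\big)^k\equiv0\pmod p$.
   Context: $[x]$ is the greatest integer not exceeding $x$. For a rational $r$ with denominator prime to $p$, $\big(\frac rp\big)$ is the Legendre symbol of its residue mod $p$; congruences are taken in the ring of such rationals, and $p\nmid r$ means $r\not\equiv0\pmod p$. -}

module Defs where

open import Data.Nat as ℕ using (ℕ; zero; suc)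
open import Data.Nat.Divisibility using (_∣_)
open import Data.Nat.Combinatorics using (_C_)
open import Data.Integer as ℤ using (ℤ; +_)
open import Data.Rational using (ℚ; ↥_; ↧ₙ_; _/_; 0ℚ; 1ℚ; _+_; _*_; _-_)
open import Data.Product using (∃; _×_)
open import Relation.Nullary using (¬_)

ℕ→ℚ : ℕ → ℚ
ℕ→ℚ n = + n / 1

pIntegral : ℕ → ℚ → Set
pIntegral p r = ¬ (p ∣ ↧ₙ r)

-- congruence a ≡ b (mod p) for p-integral rationals: p divides the
-- numerator of the reduced fraction a - b
_≡_[mod_] : ℚ → ℚ → ℕ → Set
a ≡ b [mod p ] = p ∣ ℤ.∣ ↥ (a - b) ∣

_∤ℚ_ : ℕ → ℚ → Set
p ∤ℚ r = ¬ (r ≡ 0ℚ [mod p ])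

LegendreOne : ℚ → ℕ → Set
LegendreOne r p = p ∤ℚ r × ∃ λ (x : ℤ) → r ≡ ((x ℤ.* x) / 1) [mod p ]

LegendreMinusOne : ℚ → ℕ → Set
LegendreMinusOne r p = p ∤ℚ r × ¬ (∃ λ (x : ℤ) → r ≡ ((x ℤ.* x) / 1) [mod p ])

_^ℚ_ : ℚ → ℕ → ℚ
r ^ℚ zero = 1ℚ
r ^ℚ suc k = r * (r ^ℚ k)

Σ[0≤k≤_] : ℕ → (ℕ → ℚ) → ℚ
Σ[0≤k≤ zero ] f = f 0
Σ[0≤k≤ suc n ] f = Σ[0≤k≤ n ] f + f (suc n)

binomSum : ℕ → ℚ → ℚ
binomSum n x = Σ[0≤k≤ n ] (λ k → ℕ→ℚ ((4 ℕ.* k) C (2 ℕ.* k)) * (x ^ℚ k))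

module Submission where

-- Write p = 2h + 1.  The argument runs in three steps.
--  1. Central binomial congruence: C(2j,j) ≡ C(h,j) (-4)^j (mod p) for
--     j ≤ h, since -1/2 ≡ h.  Hence C(4k,2k) t^k ≡ C(h,2k) (16t)^k, and when
--     16t ≡ w² the sum becomes the even part Σ_k C(h,2k) w^(2k) of the
--     binomial expansion, i.e. ((1+w)^h + (1-w)^h)/2.
--  2. Euler's criterion (non-residue half, via Fermat and Lagrange's bound on
--     the number of roots): if A·B is a non-residue then (AB)^h ≡ -1 while
--     B^(2h) ≡ 1, so A^h + B^h ≡ 0.  With A = c(1+w), B = c(1-w) the even
--     part vanishes (keyCongruence).
--  3. Rationals with denominator prime to p are reduced to integers mod p
--     (the relation r ↝ t).  With Q ≡ q², take w = P/(2q) in (i) and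
--     w = 2q/P in (ii): then 16x = w² for the argument x of the sum, and
--     (1+w)(1-w) is (4Q - P²)/(2q)² resp. (P² - 4Q)/P², a non-residue.

open import Defs
open import Data.Nat as ℕ using (ℕ)
open import Data.Nat.DivMod using (_/_)
open import Data.Nat.Divisibility using (_∣_)
open import Data.Nat.Primality using (Prime)
open import Data.Rational as ℚ using (ℚ; _*_; _-_; 1/_)
open import Data.Product using (_×_)
open import Relation.Nullary using (¬_)

open import Data.Nat.Base using (zero; suc)
import Data.Nat.Properties as ℕP
import Data.Nat.Tactic.RingSolver as ℕSolver
open import Data.Nat.Combinatorics using (_C_; nCk+nC[k+1]≡[n+1]C[k+1])
open import Data.Nat.Divisibility using (divides; ∣⇒≤)
open import Data.Nat.DivMod using (_%_; m%n<n; m≡m%n+[m/n]*n)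
open import Data.Nat.Primality using (euclidsLemma; ¬prime[1])
open import Data.Integer.Base using (ℤ; +_; -[1+_]; +[1+_]; -_; _+_; _^_; ∣_∣)
  renaming (_*_ to _·_; _-_ to _−_)
import Data.Integer.Properties as ℤP
import Data.Integer.Divisibility.Signed as ℤ∣
open import Data.Integer.GCD using (gcd)
open import Data.Integer.Tactic.RingSolver using (solve-∀)
open import Data.Rational.Base using (mkℚ; ↥_; ↧_)
import Data.Rational.Properties as ℚP
open import Data.Fin.Base using (Fin; toℕ) renaming (zero to fzero; suc to fsuc)
import Data.Fin.Properties as FinP
open import Data.Vec.Base using (Vec; []; _∷_; map; replicate)
open import Data.Product using (Σ; _,_; proj₁; proj₂)
open import Data.Sum using (_⊎_; inj₁; inj₂; [_,_]′)
open import Data.Empty using (⊥; ⊥-elim)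
open import Function.Base using (id)
open import Level using (0ℓ)
open import Relation.Binary.Bundles using (Setoid)
open import Relation.Binary.Definitions using (tri<; tri≈; tri>)
import Relation.Binary.Reasoning.Setoid as SetoidReasoning
open import Relation.Binary.PropositionalEquality

-- Binomial coefficients by Pascal's rule.  They agree with the library's
-- n C k (B≡C) but compute by recursion on n and k, so that the identities
-- below are proved by induction.
B : ℕ → ℕ → ℕ
B zero    zero    = 1
B zero    (suc k) = 0
B (suc n) zero    = 1
B (suc n) (suc k) = B n k ℕ.+ B n (suc k)

B≡C : ∀ n k → B n k ≡ n C k
B≡C zero    zero    = refl
B≡C zero    (suc k) = refl
B≡C (suc n) zero    = refl
B≡C (suc n) (suc k) =
  trans (cong₂ ℕ._+_ (B≡C n k) (B≡C n (suc k))) (nCk+nC[k+1]≡[n+1]C[k+1] n k)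

-- C(n,k) = 0 for k > n: the binomial sums below may run past n.
B-vanish : ∀ n k → n ℕ.< k → B n k ≡ 0
B-vanish zero    (suc k) _              = refl
B-vanish (suc n) (suc k) (ℕ.s≤s n<k) =
  cong₂ ℕ._+_ (B-vanish n k n<k) (B-vanish n (suc k) (ℕP.m<n⇒m<1+n n<k))

B-zero : ∀ n → B n 0 ≡ 1
B-zero zero    = refl
B-zero (suc n) = refl

B-diag : ∀ n → B n n ≡ 1
B-diag zero    = refl
B-diag (suc n) = cong₂ ℕ._+_ (B-diag n) (B-vanish n (suc n) (ℕP.n<1+n n))

B-absorb : ∀ n k → suc k ℕ.* B (suc n) (suc k) ≡ suc n ℕ.* B n k
B-absorb zero    zero    = refl
B-absorb zero    (suc k) = ℕP.*-zeroʳ (suc (suc k))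
B-absorb (suc n) zero    = cong suc (trans (ℕP.+-identityʳ _) (B-one (suc n)))
  where
  B-one : ∀ n → B n 1 ≡ n ℕ.* 1
  B-one zero    = refl
  B-one (suc n) = cong₂ ℕ._+_ (B-zero n) (B-one n)
B-absorb (suc n) (suc k) = begin
    suc (suc k) ℕ.* (X ℕ.+ Y)
  ≡⟨ split k X Y ⟩
    suc k ℕ.* X ℕ.+ X ℕ.+ suc (suc k) ℕ.* Y
  ≡⟨ cong₂ (λ a b → a ℕ.+ X ℕ.+ b) (B-absorb n k) (B-absorb n (suc k)) ⟩
    suc n ℕ.* B n k ℕ.+ X ℕ.+ suc n ℕ.* B n (suc k)
  ≡⟨ merge n (B n k) (B n (suc k)) ⟩
    suc (suc n) ℕ.* (B n k ℕ.+ B n (suc k))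
  ∎
  where
  open ≡-Reasoning
  X Y : ℕ
  X = B (suc n) (suc k)
  Y = B (suc n) (suc (suc k))
  split : ∀ k X Y → suc (suc k) ℕ.* (X ℕ.+ Y) ≡ suc k ℕ.* X ℕ.+ X ℕ.+ suc (suc k) ℕ.* Y
  split = ℕSolver.solve-∀
  merge : ∀ n a b → suc n ℕ.* a ℕ.+ (a ℕ.+ b) ℕ.+ suc n ℕ.* b ≡ suc (suc n) ℕ.* (a ℕ.+ b)
  merge = ℕSolver.solve-∀

-- The ratio of consecutive coefficients, (k+1) C(n,k+1) = (n-k) C(n,k),
-- in subtraction-free form.
B-ratio : ∀ n k → suc k ℕ.* B n (suc k) ℕ.+ suc k ℕ.* B n k ≡ suc n ℕ.* B n k
B-ratio n k = begin
    suc k ℕ.* B n (suc k) ℕ.+ suc k ℕ.* B n k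
  ≡⟨ ℕP.+-comm (suc k ℕ.* B n (suc k)) _ ⟩
    suc k ℕ.* B n k ℕ.+ suc k ℕ.* B n (suc k)
  ≡⟨ ℕP.*-distribˡ-+ (suc k) (B n k) (B n (suc k)) ⟨
    suc k ℕ.* B (suc n) (suc k)
  ≡⟨ B-absorb n k ⟩
    suc n ℕ.* B n k
  ∎
  where open ≡-Reasoning

B-odd-central : ∀ j → suc j ℕ.* B (suc (j ℕ.+ j)) j ≡ suc (j ℕ.+ j) ℕ.* B (j ℕ.+ j) j
B-odd-central zero    = refl
B-odd-central (suc i) = ℕP.*-cancelˡ-≡ _ _ (suc i) (begin
    suc i ℕ.* (suc j ℕ.* Z)
  ≡⟨ swap i j Z ⟩
    suc j ℕ.* (j ℕ.* Z)
  ≡⟨ cong (suc j ℕ.*_) (B-absorb (j ℕ.+ j) i) ⟩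
    suc j ℕ.* (n ℕ.* X)
  ≡⟨ swap j (j ℕ.+ j) X ⟩
    n ℕ.* (suc j ℕ.* X)
  ≡⟨ cong (n ℕ.*_) jY≡[j+1]X ⟨
    n ℕ.* (j ℕ.* Y)
  ≡⟨ swap (j ℕ.+ j) i Y ⟩
    suc i ℕ.* (n ℕ.* Y)
  ∎)
  where
  open ≡-Reasoning
  j n X Y Z : ℕ
  j = suc i
  n = suc (j ℕ.+ j)
  X = B (j ℕ.+ j) i
  Y = B (j ℕ.+ j) j
  Z = B n j
  swap : ∀ a b c → suc a ℕ.* (suc b ℕ.* c) ≡ suc b ℕ.* (suc a ℕ.* c)
  swap = ℕSolver.solve-∀
  -- the ratio identity at (2j, j-1): j C(2j,j) = (j+1) C(2j,j-1)
  jY≡[j+1]X : j ℕ.* Y ≡ suc j ℕ.* X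
  jY≡[j+1]X = ℕP.+-cancelʳ-≡ (j ℕ.* X) _ _ (trans (B-ratio (j ℕ.+ j) i) (expand j X))
    where
    expand : ∀ j X → suc (j ℕ.+ j) ℕ.* X ≡ suc j ℕ.* X ℕ.+ j ℕ.* X
    expand = ℕSolver.solve-∀

B-central-step : ∀ j →
  suc j ℕ.* B (suc (suc (j ℕ.+ j))) (suc j) ≡ 2 ℕ.* suc (j ℕ.+ j) ℕ.* B (j ℕ.+ j) j
B-central-step j = ℕP.*-cancelˡ-≡ _ _ (suc j) (begin
    suc j ℕ.* (suc j ℕ.* B (suc (suc (j ℕ.+ j))) (suc j))
  ≡⟨ cong (suc j ℕ.*_) (B-absorb (suc (j ℕ.+ j)) j) ⟩
    suc j ℕ.* (suc (suc (j ℕ.+ j)) ℕ.* Z)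
  ≡⟨ regroup j Z ⟩
    2 ℕ.* (suc j ℕ.* (suc j ℕ.* Z))
  ≡⟨ cong (λ a → 2 ℕ.* (suc j ℕ.* a)) (B-odd-central j) ⟩
    2 ℕ.* (suc j ℕ.* (suc (j ℕ.+ j) ℕ.* B (j ℕ.+ j) j))
  ≡⟨ reassoc j (B (j ℕ.+ j) j) ⟩
    suc j ℕ.* (2 ℕ.* suc (j ℕ.+ j) ℕ.* B (j ℕ.+ j) j)
  ∎)
  where
  open ≡-Reasoning
  Z : ℕ
  Z = B (suc (j ℕ.+ j)) j
  regroup : ∀ j Z → suc j ℕ.* (suc (suc (j ℕ.+ j)) ℕ.* Z) ≡ 2 ℕ.* (suc j ℕ.* (suc j ℕ.* Z))
  regroup = ℕSolver.solve-∀
  reassoc : ∀ j Y → 2 ℕ.* (suc j ℕ.* (suc (j ℕ.+ j) ℕ.* Y)) ≡ suc j ℕ.* (2 ℕ.* suc (j ℕ.+ j) ℕ.* Y)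
  reassoc = ℕSolver.solve-∀

^-distrib-· : ∀ x y n → (x · y) ^ n ≡ x ^ n · y ^ n
^-distrib-· x y zero    = refl
^-distrib-· x y (suc n) = trans (cong ((x · y) ·_) (^-distrib-· x y n)) (interchange x y (x ^ n) (y ^ n))
  where
  interchange : ∀ x y a b → (x · y) · (a · b) ≡ (x · a) · (y · b)
  interchange = solve-∀

^-double : ∀ x k → x ^ (k ℕ.+ k) ≡ (x · x) ^ k
^-double x k = trans (ℤP.^-distribˡ-+-* x k k) (sym (^-distrib-· x x k))

^-neg-even : ∀ x k → (- x) ^ (k ℕ.+ k) ≡ x ^ (k ℕ.+ k)
^-neg-even x k = begin
    (- x) ^ (k ℕ.+ k)  ≡⟨ ^-double (- x) k ⟩
    ((- x) · (- x)) ^ k ≡⟨ cong (_^ k) (negSquare x) ⟩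
    (x · x) ^ k        ≡⟨ ^-double x k ⟨
    x ^ (k ℕ.+ k)      ∎
  where
  open ≡-Reasoning
  negSquare : ∀ x → (- x) · (- x) ≡ x · x
  negSquare = solve-∀

^-neg-odd : ∀ x k → (- x) ^ suc (k ℕ.+ k) ≡ - x ^ suc (k ℕ.+ k)
^-neg-odd x k = trans (cong ((- x) ·_) (^-neg-even x k)) (sym (ℤP.neg-distribˡ-* x _))

Σℤ[0≤k≤_] : ℕ → (ℕ → ℤ) → ℤ
Σℤ[0≤k≤ zero ]  f = f 0
Σℤ[0≤k≤ suc n ] f = Σℤ[0≤k≤ n ] f + f (suc n)

Σℤ-ext : ∀ n {f g : ℕ → ℤ} → (∀ k → k ℕ.≤ n → f k ≡ g k) → Σℤ[0≤k≤ n ] f ≡ Σℤ[0≤k≤ n ] g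
Σℤ-ext zero    f≡g = f≡g 0 ℕ.z≤n
Σℤ-ext (suc n) f≡g =
  cong₂ _+_ (Σℤ-ext n (λ k k≤n → f≡g k (ℕP.m≤n⇒m≤1+n k≤n))) (f≡g (suc n) ℕP.≤-refl)

Σℤ-+ : ∀ n (f g : ℕ → ℤ) → Σℤ[0≤k≤ n ] (λ k → f k + g k) ≡ Σℤ[0≤k≤ n ] f + Σℤ[0≤k≤ n ] g
Σℤ-+ zero    f g = refl
Σℤ-+ (suc n) f g = trans (cong (_+ (f (suc n) + g (suc n))) (Σℤ-+ n f g))
                         (interchange (Σℤ[0≤k≤ n ] f) (Σℤ[0≤k≤ n ] g) (f (suc n)) (g (suc n)))
  where
  interchange : ∀ a b c d → (a + b) + (c + d) ≡ (a + c) + (b + d)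
  interchange = solve-∀

Σℤ-scale : ∀ n c (f : ℕ → ℤ) → Σℤ[0≤k≤ n ] (λ k → c · f k) ≡ c · Σℤ[0≤k≤ n ] f
Σℤ-scale zero    c f = refl
Σℤ-scale (suc n) c f = trans (cong (_+ c · f (suc n)) (Σℤ-scale n c f)) (sym (ℤP.*-distribˡ-+ c _ _))

Σℤ-pairs : ∀ m (u : ℕ → ℤ) →
  Σℤ[0≤k≤ suc (m ℕ.+ m) ] u ≡ Σℤ[0≤k≤ m ] (λ k → u (k ℕ.+ k) + u (suc (k ℕ.+ k)))
Σℤ-pairs zero    u = refl
Σℤ-pairs (suc m) u = begin
    Σℤ[0≤k≤ suc (suc m ℕ.+ suc m) ] u
  ≡⟨ cong (λ t → Σℤ[0≤k≤ suc t ] u) (ℕP.+-suc (suc m) m) ⟩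
    Σℤ[0≤k≤ suc (m ℕ.+ m) ] u + u (suc (suc (m ℕ.+ m))) + u (suc (suc (suc (m ℕ.+ m))))
  ≡⟨ ℤP.+-assoc (Σℤ[0≤k≤ suc (m ℕ.+ m) ] u) _ _ ⟩
    Σℤ[0≤k≤ suc (m ℕ.+ m) ] u + (u (suc (suc (m ℕ.+ m))) + u (suc (suc (suc (m ℕ.+ m)))))
  ≡⟨ cong₂ (λ s t → s + (u t + u (suc t))) (Σℤ-pairs m u) (sym (ℕP.+-suc (suc m) m)) ⟩
    Σℤ[0≤k≤ m ] pair + pair (suc m)
  ∎
  where
  open ≡-Reasoning
  pair : ℕ → ℤ
  pair k = u (k ℕ.+ k) + u (suc (k ℕ.+ k))

binomPartial : ℕ → ℕ → ℤ → ℤ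
binomPartial n N w = Σℤ[0≤k≤ N ] (λ j → + B n j · w ^ j)

-- Pascal's rule, summed: S(n+1, N+1) = S(n, N+1) + w S(n, N).
binomPartial-step : ∀ n N w →
  binomPartial (suc n) (suc N) w ≡ binomPartial n (suc N) w + w · binomPartial n N w
binomPartial-step n zero w rewrite B-zero n | ℤP.pos-+ 1 (B n 1) = rearrange (+ B n 1) w
  where
  rearrange : ∀ b w → + 1 · + 1 + (+ 1 + b) · (w · + 1) ≡ + 1 · + 1 + b · (w · + 1) + w · (+ 1 · + 1)
  rearrange = solve-∀
binomPartial-step n (suc N) w = begin
    binomPartial (suc n) (suc N) w + + (B n (suc N) ℕ.+ B n (suc (suc N))) · w ^ suc (suc N)
  ≡⟨ cong₂ (λ a b → a + b · w ^ suc (suc N)) (binomPartial-step n N w) (ℤP.pos-+ (B n (suc N)) _) ⟩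
    S + w · binomPartial n N w + (+ B n (suc N) + + B n (suc (suc N))) · (w · (w · w ^ N))
  ≡⟨ rearrange (binomPartial n N w) (+ B n (suc N)) (+ B n (suc (suc N))) w (w ^ N) ⟩
    S + + B n (suc (suc N)) · (w · (w · w ^ N)) + w · S
  ∎
  where
  open ≡-Reasoning
  S : ℤ
  S = binomPartial n (suc N) w
  rearrange : ∀ s b c w q → s + b · (w · q) + w · s + (b + c) · (w · (w · q))
                          ≡ s + b · (w · q) + c · (w · (w · q)) + w · (s + b · (w · q))
  rearrange = solve-∀

binomPartial-stable : ∀ n N w → n ℕ.≤ N → binomPartial n N w ≡ binomPartial n n w
binomPartial-stable n N w n≤N = trans (cong (λ t → binomPartial n t w) (sym (ℕP.m∸n+n≡m n≤N)))
                                      (beyond (N ℕ.∸ n))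
  where
  beyond : ∀ d → binomPartial n (d ℕ.+ n) w ≡ binomPartial n n w
  beyond zero    = refl
  beyond (suc d) = begin
      binomPartial n (d ℕ.+ n) w + + B n (suc (d ℕ.+ n)) · w ^ suc (d ℕ.+ n)
    ≡⟨ cong₂ (λ s b → s + + b · w ^ suc (d ℕ.+ n)) (beyond d)
             (B-vanish n (suc (d ℕ.+ n)) (ℕ.s≤s (ℕP.m≤n+m n d))) ⟩
      binomPartial n n w + + 0 · w ^ suc (d ℕ.+ n)
    ≡⟨ cong (λ z → binomPartial n n w + z) (ℤP.*-zeroˡ (w ^ suc (d ℕ.+ n))) ⟩
      binomPartial n n w + + 0
    ≡⟨ ℤP.+-identityʳ _ ⟩
      binomPartial n n w
    ∎
    where open ≡-Reasoning

binomialTheorem : ∀ n w → (+ 1 + w) ^ n ≡ binomPartial n n w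
binomialTheorem zero    w = refl
binomialTheorem (suc n) w = begin
    (+ 1 + w) · (+ 1 + w) ^ n
  ≡⟨ cong ((+ 1 + w) ·_) (binomialTheorem n w) ⟩
    (+ 1 + w) · binomPartial n n w
  ≡⟨ expand w (binomPartial n n w) ⟩
    binomPartial n n w + w · binomPartial n n w
  ≡⟨ cong (_+ w · binomPartial n n w) (binomPartial-stable n (suc n) w (ℕP.n≤1+n n)) ⟨
    binomPartial n (suc n) w + w · binomPartial n n w
  ≡⟨ binomPartial-step n n w ⟨
    binomPartial (suc n) (suc n) w
  ∎
  where
  open ≡-Reasoning
  expand : ∀ w s → (+ 1 + w) · s ≡ s + w · s
  expand = solve-∀

evenPart : ℕ → ℕ → ℤ → ℤ
evenPart n m w = Σℤ[0≤k≤ m ] (λ k → + B n (k ℕ.+ k) · w ^ (k ℕ.+ k))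

-- (1+w)^n + (1-w)^n = 2 Σ_{k≤m} C(n,2k) w^(2k)  whenever n ≤ 2m+1:
-- the odd-index terms cancel.
evenPart-spec : ∀ n m w → n ℕ.≤ suc (m ℕ.+ m) →
  (+ 1 + w) ^ n + (+ 1 + - w) ^ n ≡ + 2 · evenPart n m w
evenPart-spec n m w n≤N = begin
    (+ 1 + w) ^ n + (+ 1 + - w) ^ n
  ≡⟨ cong₂ _+_ (binomialTheorem n w) (binomialTheorem n (- w)) ⟩
    binomPartial n n w + binomPartial n n (- w)
  ≡⟨ cong₂ _+_ (binomPartial-stable n N w n≤N) (binomPartial-stable n N (- w) n≤N) ⟨
    binomPartial n N w + binomPartial n N (- w)
  ≡⟨ Σℤ-+ N _ _ ⟨
    Σℤ[0≤k≤ N ] (λ j → term w j + term (- w) j)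
  ≡⟨ Σℤ-pairs m _ ⟩
    Σℤ[0≤k≤ m ] (λ k → (term w (k ℕ.+ k) + term (- w) (k ℕ.+ k))
                       + (term w (suc (k ℕ.+ k)) + term (- w) (suc (k ℕ.+ k))))
  ≡⟨ Σℤ-ext m (λ k _ → cong₂ (λ a b → (term w (k ℕ.+ k) + + B n (k ℕ.+ k) · a)
                                      + (term w (suc (k ℕ.+ k)) + + B n (suc (k ℕ.+ k)) · b))
                             (^-neg-even w k) (^-neg-odd w k)) ⟩
    Σℤ[0≤k≤ m ] (λ k → (term w (k ℕ.+ k) + term w (k ℕ.+ k))
                       + (+ B n (suc (k ℕ.+ k)) · w ^ suc (k ℕ.+ k)
                         + + B n (suc (k ℕ.+ k)) · - w ^ suc (k ℕ.+ k)))
  ≡⟨ Σℤ-ext m (λ k _ → cancelOdd (term w (k ℕ.+ k)) (+ B n (suc (k ℕ.+ k))) (w ^ suc (k ℕ.+ k))) ⟩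
    Σℤ[0≤k≤ m ] (λ k → + 2 · term w (k ℕ.+ k))
  ≡⟨ Σℤ-scale m (+ 2) _ ⟩
    + 2 · evenPart n m w
  ∎
  where
  open ≡-Reasoning
  N : ℕ
  N = suc (m ℕ.+ m)
  term : ℤ → ℕ → ℤ
  term x j = + B n j · x ^ j
  cancelOdd : ∀ a b c → (a + a) + (b · c + b · - c) ≡ + 2 · a
  cancelOdd = solve-∀

binomSumℤ : ℕ → ℤ → ℤ
binomSumℤ m t = Σℤ[0≤k≤ m ] (λ k → + ((4 ℕ.* k) C (2 ℕ.* k)) · t ^ k)

-- horner ℓ (c₀ ∷ … ∷ cₙ₋₁) x = c₀ + c₁ x + … + cₙ₋₁ xⁿ⁻¹ + ℓ xⁿ:
-- an integer polynomial of degree n with leading coefficient ℓ.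
horner : ∀ {n} → ℤ → Vec ℤ n → ℤ → ℤ
horner ℓ []       x = ℓ
horner ℓ (c ∷ cs) x = c + x · horner ℓ cs x

horner-monomial : ∀ k x → horner (+ 1) (replicate k (+ 0)) x ≡ x ^ k
horner-monomial zero    x = refl
horner-monomial (suc k) x = trans (ℤP.+-identityˡ _) (cong (x ·_) (horner-monomial k x))

horner-addLower : ∀ n ℓ ℓ′ (u : Vec ℤ (suc n)) (v : Vec ℤ n) →
  Σ (Vec ℤ (suc n)) λ w → ∀ x → horner ℓ w x ≡ horner ℓ u x + horner ℓ′ v x
horner-addLower zero ℓ ℓ′ (u₀ ∷ []) [] = (u₀ + ℓ′) ∷ [] , λ x → rearrange u₀ ℓ′ x ℓ
  where
  rearrange : ∀ u l x m → (u + l) + x · m ≡ (u + x · m) + l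
  rearrange = solve-∀
horner-addLower (suc n) ℓ ℓ′ (u₀ ∷ us) (v₀ ∷ vs) with horner-addLower n ℓ ℓ′ us vs
... | ws , ws≡ = (u₀ + v₀) ∷ ws , λ x →
  trans (cong (λ t → (u₀ + v₀) + x · t) (ws≡ x)) (rearrange u₀ v₀ x (horner ℓ us x) (horner ℓ′ vs x))
  where
  rearrange : ∀ u v x a b → (u + v) + x · (a + b) ≡ (u + x · a) + (v + x · b)
  rearrange = solve-∀

horner-scale : ∀ {n} a ℓ (v : Vec ℤ n) x → horner (a · ℓ) (map (a ·_) v) x ≡ a · horner ℓ v x
horner-scale a ℓ []      x = refl
horner-scale a ℓ (c ∷ v) x = trans (cong (λ t → a · c + x · t) (horner-scale a ℓ v x)) (factorOut a c x (horner ℓ v x))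
  where
  factorOut : ∀ a c x t → a · c + x · (a · t) ≡ a · (c + x · t)
  factorOut = solve-∀

factorTheorem : ∀ n ℓ (f : Vec ℤ (suc n)) a →
  Σ (Vec ℤ n) λ g → ∀ x → horner ℓ f x − horner ℓ f a ≡ (x − a) · horner ℓ g x
factorTheorem zero ℓ (c ∷ []) a = [] , λ x → linear c x a ℓ
  where
  linear : ∀ c x a l → c + x · l − (c + a · l) ≡ (x − a) · l
  linear = solve-∀
factorTheorem (suc n) ℓ (c ∷ cs) a with factorTheorem n ℓ cs a
... | G , G-spec with horner-addLower n ℓ (a · ℓ) cs (map (a ·_) G)
... | g , g-spec = g , λ x → begin
      c + x · horner ℓ cs x − (c + a · horner ℓ cs a)
    ≡⟨ peel c x a (horner ℓ cs x) (horner ℓ cs a) ⟩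
      (x − a) · horner ℓ cs x + a · (horner ℓ cs x − horner ℓ cs a)
    ≡⟨ cong (λ t → (x − a) · horner ℓ cs x + a · t) (G-spec x) ⟩
      (x − a) · horner ℓ cs x + a · ((x − a) · horner ℓ G x)
    ≡⟨ collect x a (horner ℓ cs x) (horner ℓ G x) ⟩
      (x − a) · (horner ℓ cs x + a · horner ℓ G x)
    ≡⟨ cong (λ t → (x − a) · (horner ℓ cs x + t)) (horner-scale a ℓ G x) ⟨
      (x − a) · (horner ℓ cs x + horner (a · ℓ) (map (a ·_) G) x)
    ≡⟨ cong ((x − a) ·_) (g-spec x) ⟨
      (x − a) · horner ℓ g x
    ∎
  where
  open ≡-Reasoning
  peel : ∀ c x a s t → c + x · s − (c + a · t) ≡ (x − a) · s + a · (s − t)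
  peel = solve-∀
  collect : ∀ x a s g → (x − a) · s + a · ((x − a) · g) ≡ (x − a) · (s + a · g)
  collect = solve-∀

oddPrime-form : ∀ p → Prime p → ¬ 2 ∣ p → Σ ℕ λ h′ → p ≡ suc (suc h′ ℕ.+ suc h′)
oddPrime-form p p-prime p-odd = fromRemainder (p % 2) (p / 2) (m%n<n p 2) (m≡m%n+[m/n]*n p 2)
  where
  twice : ∀ x → x ℕ.* 2 ≡ x ℕ.+ x
  twice = ℕSolver.solve-∀
  fromRemainder : ∀ r k → r ℕ.< 2 → p ≡ r ℕ.+ k ℕ.* 2 → Σ ℕ λ h′ → p ≡ suc (suc h′ ℕ.+ suc h′)
  fromRemainder zero          k        _ p≡ = ⊥-elim (p-odd (divides k p≡))
  fromRemainder (suc zero)    zero     _ p≡ = ⊥-elim (¬prime[1] (subst Prime p≡ p-prime))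
  fromRemainder (suc zero)    (suc h′) _ p≡ = h′ , trans p≡ (cong suc (twice (suc h′)))
  fromRemainder (suc (suc r)) k (ℕ.s≤s (ℕ.s≤s ())) _

-- For p = 2h + 1, m = ⌊p/4⌋ satisfies 2m ≤ h ≤ 2m + 1: in p = r + 4m the
-- remainder r is odd, and h = 2m if r = 1, h = 2m + 1 if r = 3.
quarter-bounds : ∀ h → let m = suc (h ℕ.+ h) / 4 in m ℕ.+ m ℕ.≤ h × h ℕ.≤ suc (m ℕ.+ m)
quarter-bounds h = fromRemainder (suc (h ℕ.+ h) % 4) (suc (h ℕ.+ h) / 4)
                                 (m%n<n (suc (h ℕ.+ h)) 4) (m≡m%n+[m/n]*n (suc (h ℕ.+ h)) 4)
  where
  double : ∀ x → 2 ℕ.* x ≡ x ℕ.+ x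
  double = ℕSolver.solve-∀
  odd≢even : ∀ a b → suc (a ℕ.+ a) ≢ b ℕ.+ b
  odd≢even a b e = ℕP.even≢odd b a (trans (double b) (trans (sym e) (cong suc (sym (double a)))))
  halve : ∀ a b → a ℕ.+ a ≡ b ℕ.+ b → a ≡ b
  halve a b e = ℕP.*-cancelˡ-≡ a b 2 (trans (double a) (trans e (sym (double b))))
  fourfold : ∀ m → m ℕ.* 4 ≡ (m ℕ.+ m) ℕ.+ (m ℕ.+ m)
  fourfold = ℕSolver.solve-∀
  fourfold+2 : ∀ m → suc (suc (m ℕ.* 4)) ≡ suc (m ℕ.+ m) ℕ.+ suc (m ℕ.+ m)
  fourfold+2 = ℕSolver.solve-∀
  fromRemainder : ∀ r m → r ℕ.< 4 → suc (h ℕ.+ h) ≡ r ℕ.+ m ℕ.* 4 →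
                  m ℕ.+ m ℕ.≤ h × h ℕ.≤ suc (m ℕ.+ m)
  fromRemainder 0 m _ e = ⊥-elim (odd≢even h (m ℕ.+ m) (trans e (fourfold m)))
  fromRemainder 1 m _ e with halve h (m ℕ.+ m) (trans (ℕP.suc-injective e) (fourfold m))
  ... | refl = ℕP.≤-refl , ℕP.n≤1+n _
  fromRemainder 2 m _ e = ⊥-elim (odd≢even (m ℕ.+ m) h (sym (trans (ℕP.suc-injective e) (cong suc (fourfold m)))))
  fromRemainder 3 m _ e with halve h (suc (m ℕ.+ m)) (trans (ℕP.suc-injective e) (fourfold+2 m))
  ... | refl = ℕP.n≤1+n _ , ℕP.≤-refl
  fromRemainder (suc (suc (suc (suc r)))) m (ℕ.s≤s (ℕ.s≤s (ℕ.s≤s (ℕ.s≤s ())))) _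


module OddPrime (h′ : ℕ) (p-prime : Prime (suc (suc h′ ℕ.+ suc h′))) where

  h : ℕ
  h = suc h′

  p : ℕ
  p = suc (h ℕ.+ h)

  h<p : h ℕ.< p
  h<p = ℕ.s≤s (ℕP.m≤m+n h h)

  infix 4 p∣_
  p∣_ : ℤ → Set
  p∣ x = + p ℤ∣.∣ x

  p∣0 : p∣ + 0
  p∣0 = ℤ∣.divides (+ 0) refl

  p∣p : p∣ + p
  p∣p = ℤ∣.divides (+ 1) (sym (ℤP.*-identityˡ (+ p)))

  p∣-≡ : ∀ {x y} → x ≡ y → p∣ x → p∣ y
  p∣-≡ = subst p∣_

  p∣-+ : ∀ {x y} → p∣ x → p∣ y → p∣ (x + y)
  p∣-+ = ℤ∣.∣m∣n⇒∣m+n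

  p∣-− : ∀ {x y} → p∣ x → p∣ y → p∣ (x − y)
  p∣-− = ℤ∣.∣m∣n⇒∣m-n

  p∣-neg : ∀ {x} → p∣ x → p∣ (- x)
  p∣-neg = ℤ∣.∣m⇒∣-m

  p∣-·ˡ : ∀ a {x} → p∣ x → p∣ (a · x)
  p∣-·ˡ a = ℤ∣.∣n⇒∣m*n a

  p∣-·ʳ : ∀ {x} a → p∣ x → p∣ (x · a)
  p∣-·ʳ a = ℤ∣.∣m⇒∣m*n a

  p∣-linear : ∀ {x} a e₁ b e₂ → x ≡ a · e₁ + b · e₂ → p∣ e₁ → p∣ e₂ → p∣ x
  p∣-linear a e₁ b e₂ x≡ d₁ d₂ = p∣-≡ (sym x≡) (p∣-+ (p∣-·ˡ a d₁) (p∣-·ˡ b d₂))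

  p∣-swap : ∀ x y → p∣ (x − y) → p∣ (y − x)
  p∣-swap x y d = p∣-≡ (negate x y) (p∣-neg d)
    where
    negate : ∀ x y → - (x − y) ≡ y − x
    negate = solve-∀

  euclid : ∀ x y → p∣ (x · y) → p∣ x ⊎ p∣ y
  euclid x y d with euclidsLemma ∣ x ∣ ∣ y ∣ p-prime (subst (p ∣_) (ℤP.abs-* x y) (ℤ∣.∣⇒∣ᵤ d))
  ... | inj₁ p∣x = inj₁ (ℤ∣.∣ᵤ⇒∣ p∣x)
  ... | inj₂ p∣y = inj₂ (ℤ∣.∣ᵤ⇒∣ p∣y)

  cancel : ∀ a x → ¬ p∣ a → p∣ (a · x) → p∣ x
  cancel a x p∤a d with euclid a x d
  ... | inj₁ p∣a = ⊥-elim (p∤a p∣a)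
  ... | inj₂ p∣x = p∣x

  p∤-· : ∀ a b → ¬ p∣ a → ¬ p∣ b → ¬ p∣ (a · b)
  p∤-· a b p∤a p∤b d with euclid a b d
  ... | inj₁ p∣a = p∤a p∣a
  ... | inj₂ p∣b = p∤b p∣b

  p∤-small : ∀ n → 0 ℕ.< n → n ℕ.< p → ¬ p∣ + n
  p∤-small (suc n) _ n<p d = ℕP.<⇒≱ n<p (∣⇒≤ (ℤ∣.∣⇒∣ᵤ d))

  p∤1 : ¬ p∣ + 1
  p∤1 = p∤-small 1 (ℕ.s≤s ℕ.z≤n) (ℕ.s≤s (ℕ.s≤s ℕ.z≤n))

  p∤2 : ¬ p∣ + 2
  p∤2 = p∤-small 2 (ℕ.s≤s ℕ.z≤n)
                 (ℕ.s≤s (ℕ.s≤s (subst (1 ℕ.≤_) (sym (ℕP.+-suc h′ h′)) (ℕ.s≤s ℕ.z≤n))))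

  p∤-^ : ∀ x k → ¬ p∣ x → ¬ p∣ (x ^ k)
  p∤-^ x zero    p∤x = p∤1
  p∤-^ x (suc k) p∤x = p∤-· x (x ^ k) p∤x (p∤-^ x k p∤x)

  infix 4 _≈_
  record _≈_ (x y : ℤ) : Set where
    constructor mk≈
    field get : p∣ (x − y)
  open _≈_

  ≈-refl : ∀ {x} → x ≈ x
  ≈-refl {x} = mk≈ (p∣-≡ (sym (ℤP.+-inverseʳ x)) p∣0)

  ≡⇒≈ : ∀ {x y} → x ≡ y → x ≈ y
  ≡⇒≈ refl = ≈-refl

  ≈-sym : ∀ {x y} → x ≈ y → y ≈ x
  ≈-sym {x} {y} (mk≈ d) = mk≈ (p∣-swap x y d)

  ≈-trans : ∀ {x y z} → x ≈ y → y ≈ z → x ≈ z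
  ≈-trans {x} {y} {z} (mk≈ d₁) (mk≈ d₂) = mk≈ (p∣-linear (+ 1) (x − y) (+ 1) (y − z) (telescope x y z) d₁ d₂)
    where
    telescope : ∀ x y z → x − z ≡ + 1 · (x − y) + + 1 · (y − z)
    telescope = solve-∀

  ≈-+ : ∀ {x x′ y y′} → x ≈ x′ → y ≈ y′ → x + y ≈ x′ + y′
  ≈-+ {x} {x′} {y} {y′} (mk≈ d₁) (mk≈ d₂) =
    mk≈ (p∣-linear (+ 1) (x − x′) (+ 1) (y − y′) (expand x x′ y y′) d₁ d₂)
    where
    expand : ∀ x x′ y y′ → x + y − (x′ + y′) ≡ + 1 · (x − x′) + + 1 · (y − y′)
    expand = solve-∀

  ≈-− : ∀ {x x′ y y′} → x ≈ x′ → y ≈ y′ → x − y ≈ x′ − y′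
  ≈-− {x} {x′} {y} {y′} (mk≈ d₁) (mk≈ d₂) =
    mk≈ (p∣-linear (+ 1) (x − x′) (- + 1) (y − y′) (expand x x′ y y′) d₁ d₂)
    where
    expand : ∀ x x′ y y′ → x − y − (x′ − y′) ≡ + 1 · (x − x′) + (- + 1) · (y − y′)
    expand = solve-∀

  ≈-· : ∀ {x x′ y y′} → x ≈ x′ → y ≈ y′ → x · y ≈ x′ · y′
  ≈-· {x} {x′} {y} {y′} (mk≈ d₁) (mk≈ d₂) =
    mk≈ (p∣-linear y (x − x′) x′ (y − y′) (expand x x′ y y′) d₁ d₂)
    where
    expand : ∀ x x′ y y′ → x · y − x′ · y′ ≡ y · (x − x′) + x′ · (y − y′)
    expand = solve-∀

  ≈-^ : ∀ {x y} k → x ≈ y → x ^ k ≈ y ^ k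
  ≈-^ zero    x≈y = ≈-refl
  ≈-^ (suc k) x≈y = ≈-· x≈y (≈-^ k x≈y)

  p∣-≈ : ∀ {x y} → x ≈ y → p∣ y → p∣ x
  p∣-≈ {x} {y} (mk≈ d) p∣y = p∣-≡ (recombine x y) (p∣-+ d p∣y)
    where
    recombine : ∀ x y → x − y + y ≡ x
    recombine = solve-∀

  Σℤ-≈ : ∀ n {f g : ℕ → ℤ} → (∀ k → k ℕ.≤ n → f k ≈ g k) → Σℤ[0≤k≤ n ] f ≈ Σℤ[0≤k≤ n ] g
  Σℤ-≈ zero    f≈g = f≈g 0 ℕ.z≤n
  Σℤ-≈ (suc n) f≈g = ≈-+ (Σℤ-≈ n (λ k k≤n → f≈g k (ℕP.m≤n⇒m≤1+n k≤n))) (f≈g (suc n) ℕP.≤-refl)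

  ≈-setoid : Setoid 0ℓ 0ℓ
  ≈-setoid = record { Carrier = ℤ ; _≈_ = _≈_
                    ; isEquivalence = record { refl = ≈-refl ; sym = ≈-sym ; trans = ≈-trans } }

  module ≈-Reasoning = SetoidReasoning ≈-setoid

  -- p divides C(p,k) for 0 < k < p, since (k+1) C(p,k+1) = p C(p-1,k).
  p∣B-prime : ∀ k → 0 ℕ.< k → k ℕ.< p → p∣ + B p k
  p∣B-prime (suc k) _ k<p =
    cancel (+ suc k) (+ B p (suc k)) (p∤-small (suc k) (ℕ.s≤s ℕ.z≤n) k<p)
           (p∣-≡ absorbed (ℤ∣.divides (+ B (h ℕ.+ h) k) refl))
    where
    absorbed : + B (h ℕ.+ h) k · + p ≡ + suc k · + B p (suc k)
    absorbed = begin
      + B (h ℕ.+ h) k · + p         ≡⟨ ℤP.*-comm (+ B (h ℕ.+ h) k) (+ p) ⟩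
      + p · + B (h ℕ.+ h) k         ≡⟨ ℤP.pos-* p (B (h ℕ.+ h) k) ⟨
      + (p ℕ.* B (h ℕ.+ h) k)       ≡⟨ cong +_ (B-absorb (h ℕ.+ h) k) ⟨
      + (suc k ℕ.* B p (suc k))     ≡⟨ ℤP.pos-* (suc k) (B p (suc k)) ⟩
      + suc k · + B p (suc k)       ∎
      where open ≡-Reasoning

  binomPartial-prime : ∀ N w → N ℕ.< p → p∣ (binomPartial p N w − + 1)
  binomPartial-prime zero    w _   = p∣0
  binomPartial-prime (suc N) w N<p =
    p∣-linear (+ 1) (binomPartial p N w − + 1) (w ^ suc N) (+ B p (suc N))
              (regroup (binomPartial p N w) (+ B p (suc N)) (w ^ suc N))
              (binomPartial-prime N w (ℕP.<⇒≤ N<p)) (p∣B-prime (suc N) (ℕ.s≤s ℕ.z≤n) N<p)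
    where
    regroup : ∀ s b q → s + b · q − + 1 ≡ + 1 · (s − + 1) + q · b
    regroup = solve-∀

  -- Fermat's little theorem a^p ≡ a, first for a ≥ 0 by induction on a,
  -- using (1+a)^p ≡ 1 + a^p.
  fermat-ℕ : ∀ a → p∣ ((+ a) ^ p − + a)
  fermat-ℕ zero    = p∣-≡ (cong (_− + 0) (sym (ℤP.*-zeroˡ ((+ 0) ^ (h ℕ.+ h))))) p∣0
  fermat-ℕ (suc a) = p∣-≡ (sym split) (p∣-+ (binomPartial-prime (h ℕ.+ h) w (ℕP.n<1+n _)) (fermat-ℕ a))
    where
    w : ℤ
    w = + a
    split : (+ 1 + w) ^ p − (+ 1 + w) ≡ (binomPartial p (h ℕ.+ h) w − + 1) + (w ^ p − w)
    split = begin
        (+ 1 + w) ^ p − (+ 1 + w)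
      ≡⟨ cong (_− (+ 1 + w)) (binomialTheorem p w) ⟩
        binomPartial p (h ℕ.+ h) w + + B p p · w ^ p − (+ 1 + w)
      ≡⟨ cong (λ b → binomPartial p (h ℕ.+ h) w + + b · w ^ p − (+ 1 + w)) (B-diag p) ⟩
        binomPartial p (h ℕ.+ h) w + + 1 · w ^ p − (+ 1 + w)
      ≡⟨ regroup (binomPartial p (h ℕ.+ h) w) (w ^ p) w ⟩
        (binomPartial p (h ℕ.+ h) w − + 1) + (w ^ p − w)
      ∎
      where
      open ≡-Reasoning
      regroup : ∀ s q w → s + + 1 · q − (+ 1 + w) ≡ (s − + 1) + (q − w)
      regroup = solve-∀

  -- For a < 0 it follows because p is odd.
  fermat : ∀ a → p∣ (a ^ p − a)
  fermat (+ a)    = fermat-ℕ a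
  fermat -[1+ a ] = p∣-≡ (sym oddPower) (p∣-neg (fermat-ℕ (suc a)))
    where
    x : ℤ
    x = + suc a
    oddPower : (- x) ^ p − (- x) ≡ - (x ^ p − x)
    oddPower = trans (cong (_− (- x)) (^-neg-odd x h)) (negate (x ^ p) x)
      where
      negate : ∀ a b → - a − - b ≡ - (a − b)
      negate = solve-∀

  fermat-unit : ∀ a → ¬ p∣ a → p∣ (a ^ (h ℕ.+ h) − + 1)
  fermat-unit a p∤a = cancel a _ p∤a (p∣-≡ (factorOut a (a ^ (h ℕ.+ h))) (fermat a))
    where
    factorOut : ∀ a q → a · q − a ≡ a · (q − + 1)
    factorOut = solve-∀

  -- The inverse a^(p-2) of a unit modulo p.
  inverse : ℤ → ℤ
  inverse a = a ^ (h′ ℕ.+ h)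

  inverse-spec : ∀ a → ¬ p∣ a → inverse a · a ≈ + 1
  inverse-spec a p∤a = mk≈ (p∣-≡ (cong (_− + 1) (ℤP.*-comm a (inverse a))) (fermat-unit a p∤a))

  lagrange : ∀ n ℓ → ¬ p∣ ℓ → (f : Vec ℤ n) (r : Fin (suc n) → ℤ) →
    (∀ i j → ¬ i ≡ j → ¬ p∣ (r i − r j)) → (∀ i → p∣ horner ℓ f (r i)) → ⊥
  lagrange zero    ℓ p∤ℓ [] r distinct roots = p∤ℓ (roots fzero)
  lagrange (suc n) ℓ p∤ℓ f  r distinct roots with factorTheorem n ℓ f (r fzero)
  ... | g , g-spec = lagrange n ℓ p∤ℓ g (λ i → r (fsuc i))
    (λ i j i≢j → distinct (fsuc i) (fsuc j) (λ e → i≢j (FinP.suc-injective e)))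
    (λ i → cancel (r (fsuc i) − r fzero) _ (distinct (fsuc i) fzero (λ ()))
                  (p∣-≡ (g-spec (r (fsuc i))) (p∣-− (roots (fsuc i)) (roots fzero))))

  p∤-gap : ∀ a b → a ℕ.< b → b ℕ.< p → ¬ p∣ (+ b − + a)
  p∤-gap a b a<b b<p d =
    p∤-small (b ℕ.∸ a) (ℕP.m<n⇒0<n∸m a<b) (ℕP.≤-<-trans (ℕP.m∸n≤m b a) b<p)
             (p∣-≡ (trans (ℤP.m-n≡m⊖n b a) (ℤP.⊖-≥ (ℕP.<⇒≤ a<b))) d)

  incongruent : ∀ a b → a ℕ.< p → b ℕ.< p → p∣ (+ a − + b) → a ≡ b
  incongruent a b a<p b<p d with ℕP.<-cmp a b
  ... | tri< a<b _ _ = ⊥-elim (p∤-gap a b a<b b<p (p∣-swap (+ a) (+ b) d))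
  ... | tri≈ _ a≡b _ = a≡b
  ... | tri> _ _ b<a = ⊥-elim (p∤-gap b a b<a a<p d)

  square : Fin h → ℤ
  square i = + suc (toℕ i) · + suc (toℕ i)

  1+i<p : ∀ (i : Fin h) → suc (toℕ i) ℕ.< p
  1+i<p i = ℕP.≤-<-trans (FinP.toℕ<n i) h<p

  -- They are pairwise incongruent: x² ≡ y² forces x ≡ y or x ≡ -y, and the
  -- latter is impossible since 2 ≤ x + y ≤ 2h < p.
  squares-distinct : ∀ i j → ¬ i ≡ j → ¬ p∣ (square i − square j)
  squares-distinct i j i≢j d =
    [ (λ p∣x-y → i≢j (FinP.toℕ-injective (ℕP.suc-injective
                   (incongruent (suc (toℕ i)) (suc (toℕ j)) (1+i<p i) (1+i<p j) p∣x-y))))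
    , (λ p∣x+y → p∤-small (suc (toℕ i) ℕ.+ suc (toℕ j)) (ℕ.s≤s ℕ.z≤n)
                   (ℕ.s≤s (ℕP.+-mono-≤ (FinP.toℕ<n i) (FinP.toℕ<n j))) p∣x+y)
    ]′ (euclid (x − y) (x + y) (p∣-≡ (differenceOfSquares x y) d))
    where
    x y : ℤ
    x = + suc (toℕ i)
    y = + suc (toℕ j)
    differenceOfSquares : ∀ x y → x · x − y · y ≡ (x − y) · (x + y)
    differenceOfSquares = solve-∀

  squares-roots : ∀ i → p∣ (square i ^ h − + 1)
  squares-roots i = p∣-≡ (cong (_− + 1) (^-double x h))
                         (fermat-unit x (p∤-small (suc (toℕ i)) (ℕ.s≤s ℕ.z≤n) (1+i<p i)))
    where
    x : ℤ
    x = + suc (toℕ i)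

  xʰ-1 : Vec ℤ h
  xʰ-1 = - + 1 ∷ replicate h′ (+ 0)

  xʰ-1-spec : ∀ x → horner (+ 1) xʰ-1 x ≡ x ^ h − + 1
  xʰ-1-spec x = trans (cong (λ t → - + 1 + x · t) (horner-monomial h′ x)) (ℤP.+-comm (- + 1) (x ^ h))

  -- a is congruent to no square (0 included, so p ∤ a): a quadratic non-residue.
  NonResidue : ℤ → Set
  NonResidue a = ¬ Σ ℤ λ s → a ≈ s · s

  nonresidue-≈ : ∀ {x y} → x ≈ y → NonResidue y → NonResidue x
  nonresidue-≈ x≈y nonres (s , x≈s²) = nonres (s , ≈-trans (≈-sym x≈y) x≈s²)

  -- A non-residue a is not a root of x^h - 1: otherwise a and the h squares
  -- would be h + 1 incongruent roots, contradicting Lagrange.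
  nonresidue-not-root : ∀ a → NonResidue a → ¬ p∣ (a ^ h − + 1)
  nonresidue-not-root a nonres p∣aʰ-1 = lagrange h (+ 1) p∤1 xʰ-1 roots distinct isRoot
    where
    roots : Fin (suc h) → ℤ
    roots fzero    = a
    roots (fsuc i) = square i

    distinct : ∀ i j → ¬ i ≡ j → ¬ p∣ (roots i − roots j)
    distinct fzero    fzero    i≢j _ = i≢j refl
    distinct fzero    (fsuc j) _   d = nonres (+ suc (toℕ j) , mk≈ d)
    distinct (fsuc i) fzero    _   d = nonres (+ suc (toℕ i) , mk≈ (p∣-swap (square i) a d))
    distinct (fsuc i) (fsuc j) i≢j d = squares-distinct i j (λ e → i≢j (cong fsuc e)) d

    isRoot : ∀ i → p∣ horner (+ 1) xʰ-1 (roots i)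
    isRoot fzero    = p∣-≡ (sym (xʰ-1-spec a)) p∣aʰ-1
    isRoot (fsuc i) = p∣-≡ (sym (xʰ-1-spec (square i))) (squares-roots i)

  -- Euler's criterion for non-residues: a^h ≡ -1, since a^(2h) ≡ 1 gives
  -- p | (a^h - 1)(a^h + 1).
  euler-nonresidue : ∀ a → NonResidue a → p∣ (a ^ h + + 1)
  euler-nonresidue a nonres =
    [ (λ p∣aʰ-1 → ⊥-elim (nonresidue-not-root a nonres p∣aʰ-1)) , id ]′
      (euclid (a ^ h − + 1) (a ^ h + + 1) (p∣-≡ factorise (fermat-unit a p∤a)))
    where
    p∤a : ¬ p∣ a
    p∤a d = nonres (+ 0 , mk≈ (p∣-≡ (sym (ℤP.+-identityʳ a)) d))
    differenceOfSquares : ∀ q → q · q − + 1 ≡ (q − + 1) · (q + + 1)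
    differenceOfSquares = solve-∀
    factorise : a ^ (h ℕ.+ h) − + 1 ≡ (a ^ h − + 1) · (a ^ h + + 1)
    factorise = trans (cong (_− + 1) (ℤP.^-distribˡ-+-* a h h)) (differenceOfSquares (a ^ h))

  -- The central binomial coefficients modulo p:  C(2j,j) ≡ C(h,j) (-4)^j
  -- for j ≤ h.  (Indeed C(2j,j) = (-4)^j C(-1/2,j) and -1/2 ≡ h.)  The
  -- induction compares the ratios of consecutive terms, 2(2j+1)/(j+1) and
  -- -4(h-j)/(j+1), which agree modulo p = 2h + 1.
  centralBinomial : ∀ j → j ℕ.≤ h → + B (j ℕ.+ j) j ≈ + B h j · (- + 4) ^ j
  centralBinomial zero    _   = ≈-refl
  centralBinomial (suc j) j<h = mk≈ (cancel (+ suc j) _ (p∤-small (suc j) (ℕ.s≤s ℕ.z≤n) (ℕP.≤-<-trans j<h h<p))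
    (p∣-linear (+ 2 · (+ 1 + jℤ + jℤ)) (c − d · u) (+ 2 · d · u) (+ p) scaled
               (get (centralBinomial j (ℕP.<⇒≤ j<h))) p∣p))
    where
    open ≡-Reasoning
    jℤ hℤ c d e f u : ℤ
    jℤ = + j
    hℤ = + h
    c = + B (j ℕ.+ j) j
    d = + B h j
    e = + B h (suc j)
    f = + B (suc j ℕ.+ suc j) (suc j)
    u = (- + 4) ^ j
    centralStep : + suc j · f ≡ (+ 2 · (+ 1 + jℤ + jℤ)) · c
    centralStep = begin
        + suc j · f
      ≡⟨ cong (λ n → + suc j · + B n (suc j)) (ℕP.+-suc (suc j) j) ⟩
        + suc j · + B (suc (suc (j ℕ.+ j))) (suc j)
      ≡⟨ ℤP.pos-* (suc j) _ ⟨
        + (suc j ℕ.* B (suc (suc (j ℕ.+ j))) (suc j))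
      ≡⟨ cong +_ (B-central-step j) ⟩
        + (2 ℕ.* suc (j ℕ.+ j) ℕ.* B (j ℕ.+ j) j)
      ≡⟨ ℤP.pos-* (2 ℕ.* suc (j ℕ.+ j)) _ ⟩
        + (2 ℕ.* suc (j ℕ.+ j)) · c
      ≡⟨ cong (_· c) (ℤP.pos-* 2 (suc (j ℕ.+ j))) ⟩
        (+ 2 · (+ 1 + jℤ + jℤ)) · c
      ∎
    ratioStep : + suc j · e ≡ (+ 1 + hℤ) · d − + suc j · d
    ratioStep = begin
        + suc j · e
      ≡⟨ cancelʳ (+ suc j · e) (+ suc j · d) ⟨
        + suc j · e + + suc j · d − + suc j · d
      ≡⟨ cong₂ (λ a b → a + b − + suc j · d) (ℤP.pos-* (suc j) (B h (suc j))) (ℤP.pos-* (suc j) (B h j)) ⟨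
        + (suc j ℕ.* B h (suc j)) + + (suc j ℕ.* B h j) − + suc j · d
      ≡⟨ cong (_− + suc j · d) (ℤP.pos-+ (suc j ℕ.* B h (suc j)) (suc j ℕ.* B h j)) ⟨
        + (suc j ℕ.* B h (suc j) ℕ.+ suc j ℕ.* B h j) − + suc j · d
      ≡⟨ cong (λ n → + n − + suc j · d) (B-ratio h j) ⟩
        + (suc h ℕ.* B h j) − + suc j · d
      ≡⟨ cong (_− + suc j · d) (ℤP.pos-* (suc h) (B h j)) ⟩
        (+ 1 + hℤ) · d − + suc j · d
      ∎
      where
      cancelʳ : ∀ a b → a + b − b ≡ a
      cancelʳ = solve-∀
    scaled : + suc j · (f − e · (- + 4) ^ suc j) ≡ (+ 2 · (+ 1 + jℤ + jℤ)) · (c − d · u) + (+ 2 · d · u) · + p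
    scaled = begin
        + suc j · (f − e · ((- + 4) · u))
      ≡⟨ distribute (+ suc j) f e u ⟩
        + suc j · f + (+ 4 · u) · (+ suc j · e)
      ≡⟨ cong₂ (λ a b → a + (+ 4 · u) · b) centralStep ratioStep ⟩
        (+ 2 · (+ 1 + jℤ + jℤ)) · c + (+ 4 · u) · ((+ 1 + hℤ) · d − (+ 1 + jℤ) · d)
      ≡⟨ regroup jℤ hℤ c d u ⟩
        (+ 2 · (+ 1 + jℤ + jℤ)) · (c − d · u) + (+ 2 · d · u) · (+ 1 + hℤ + hℤ)
      ∎
      where
      distribute : ∀ k f e u → k · (f − e · ((- + 4) · u)) ≡ k · f + (+ 4 · u) · (k · e)
      distribute = solve-∀
      regroup : ∀ jℤ hℤ c d u → (+ 2 · (+ 1 + jℤ + jℤ)) · c + (+ 4 · u) · ((+ 1 + hℤ) · d − (+ 1 + jℤ) · d)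
                            ≡ (+ 2 · (+ 1 + jℤ + jℤ)) · (c − d · u) + (+ 2 · d · u) · (+ 1 + hℤ + hℤ)
      regroup = solve-∀

  -- If 16t ≡ w² and 2m ≤ h then Σ_{k≤m} C(4k,2k) t^k ≡ Σ_{k≤m} C(h,2k) w^(2k),
  -- termwise by the central binomial congruence: C(4k,2k) ≡ C(h,2k) 16^k.
  binomSum≈evenPart : ∀ m t w → m ℕ.+ m ℕ.≤ h → + 16 · t ≈ w · w → binomSumℤ m t ≈ evenPart h m w
  binomSum≈evenPart m t w 2m≤h 16t≈w² = Σℤ-≈ m term
    where
    fourfold : ∀ k → 4 ℕ.* k ≡ k ℕ.+ k ℕ.+ (k ℕ.+ k)
    fourfold = ℕSolver.solve-∀
    twofold : ∀ k → 2 ℕ.* k ≡ k ℕ.+ k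
    twofold = ℕSolver.solve-∀
    term : ∀ k → k ℕ.≤ m → + ((4 ℕ.* k) C (2 ℕ.* k)) · t ^ k ≈ + B h (k ℕ.+ k) · w ^ (k ℕ.+ k)
    term k k≤m = begin
        + ((4 ℕ.* k) C (2 ℕ.* k)) · t ^ k
      ≡⟨ cong (λ b → + b · t ^ k) (B≡C (4 ℕ.* k) (2 ℕ.* k)) ⟨
        + B (4 ℕ.* k) (2 ℕ.* k) · t ^ k
      ≡⟨ cong₂ (λ a b → + B a b · t ^ k) (fourfold k) (twofold k) ⟩
        + B (k ℕ.+ k ℕ.+ (k ℕ.+ k)) (k ℕ.+ k) · t ^ k
      ≈⟨ ≈-· (centralBinomial (k ℕ.+ k) (ℕP.≤-trans (ℕP.+-mono-≤ k≤m k≤m) 2m≤h)) (≈-refl {t ^ k}) ⟩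
        + B h (k ℕ.+ k) · (- + 4) ^ (k ℕ.+ k) · t ^ k
      ≡⟨ cong (λ z → + B h (k ℕ.+ k) · z · t ^ k) (^-double (- + 4) k) ⟩
        + B h (k ℕ.+ k) · (+ 16) ^ k · t ^ k
      ≡⟨ ℤP.*-assoc (+ B h (k ℕ.+ k)) ((+ 16) ^ k) (t ^ k) ⟩
        + B h (k ℕ.+ k) · ((+ 16) ^ k · t ^ k)
      ≡⟨ cong (+ B h (k ℕ.+ k) ·_) (^-distrib-· (+ 16) t k) ⟨
        + B h (k ℕ.+ k) · (+ 16 · t) ^ k
      ≈⟨ ≈-· (≈-refl {+ B h (k ℕ.+ k)}) (≈-^ k 16t≈w²) ⟩
        + B h (k ℕ.+ k) · (w · w) ^ k
      ≡⟨ cong (+ B h (k ℕ.+ k) ·_) (^-double w k) ⟨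
        + B h (k ℕ.+ k) · w ^ (k ℕ.+ k)
      ∎
      where open ≈-Reasoning

  -- If A·B is a non-residue then A^h + B^h ≡ 0: multiplied by B^h it becomes
  -- (AB)^h + B^(2h) ≡ -1 + 1, by Euler's criterion and Fermat.
  powerSum-vanishes : ∀ A B → NonResidue (A · B) → p∣ (A ^ h + B ^ h)
  powerSum-vanishes A B nonres = cancel (B ^ h) _ (p∤-^ B h p∤B)
      (p∣-linear (+ 1) ((A · B) ^ h + + 1) (+ 1) (B ^ (h ℕ.+ h) − + 1) expand
                 (euler-nonresidue (A · B) nonres) (fermat-unit B p∤B))
    where
    p∤B : ¬ p∣ B
    p∤B d = nonres (+ 0 , mk≈ (p∣-≡ (sym (ℤP.+-identityʳ (A · B))) (p∣-·ˡ A d)))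
    regroup : ∀ a b → b · (a + b) ≡ + 1 · (a · b + + 1) + + 1 · (b · b − + 1)
    regroup = solve-∀
    expand : B ^ h · (A ^ h + B ^ h) ≡ + 1 · ((A · B) ^ h + + 1) + + 1 · (B ^ (h ℕ.+ h) − + 1)
    expand = trans (regroup (A ^ h) (B ^ h))
                   (cong₂ (λ a b → + 1 · (a + + 1) + + 1 · (b − + 1))
                          (sym (^-distrib-· A B h)) (sym (ℤP.^-distribˡ-+-* B h h)))

  evenPart-vanishes : ∀ m c w → h ℕ.≤ suc (m ℕ.+ m) → ¬ p∣ c →
    NonResidue ((c + c · w) · (c − c · w)) → p∣ evenPart h m w
  evenPart-vanishes m c w h≤2m+1 p∤c nonres =
    cancel (+ 2) _ p∤2 (cancel (c ^ h) _ (p∤-^ c h p∤c)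
      (p∣-≡ factorised (powerSum-vanishes (c + c · w) (c − c · w) nonres)))
    where
    open ≡-Reasoning
    factor₁ : ∀ c w → c + c · w ≡ c · (+ 1 + w)
    factor₁ = solve-∀
    factor₂ : ∀ c w → c − c · w ≡ c · (+ 1 + - w)
    factor₂ = solve-∀
    factorised : (c + c · w) ^ h + (c − c · w) ^ h ≡ c ^ h · (+ 2 · evenPart h m w)
    factorised = begin
        (c + c · w) ^ h + (c − c · w) ^ h
      ≡⟨ cong₂ (λ a b → a ^ h + b ^ h) (factor₁ c w) (factor₂ c w) ⟩
        (c · (+ 1 + w)) ^ h + (c · (+ 1 + - w)) ^ h
      ≡⟨ cong₂ _+_ (^-distrib-· c (+ 1 + w) h) (^-distrib-· c (+ 1 + - w) h) ⟩
        c ^ h · (+ 1 + w) ^ h + c ^ h · (+ 1 + - w) ^ h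
      ≡⟨ ℤP.*-distribˡ-+ (c ^ h) _ _ ⟨
        c ^ h · ((+ 1 + w) ^ h + (+ 1 + - w) ^ h)
      ≡⟨ cong (c ^ h ·_) (evenPart-spec h m w h≤2m+1) ⟩
        c ^ h · (+ 2 · evenPart h m w)
      ∎

  -- If p ∤ c, 16 t c² ≡ d² and (c+d)(c-d) is a
  -- non-residue, then Σ_{k≤m} C(4k,2k) t^k ≡ 0 for 2m ≤ h ≤ 2m+1: with
  -- w = d/c we have 16t ≡ w², so the sum is the even part of (1+w)^h.
  keyCongruence : ∀ m → m ℕ.+ m ℕ.≤ h → h ℕ.≤ suc (m ℕ.+ m) → ∀ t c d → ¬ p∣ c →
    + 16 · t · (c · c) ≈ d · d → NonResidue ((c + d) · (c − d)) → p∣ binomSumℤ m t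
  keyCongruence m 2m≤h h≤2m+1 t c d p∤c 16tc²≈d² nonres =
    p∣-≈ (binomSum≈evenPart m t w 2m≤h 16t≈w²) (evenPart-vanishes m c w h≤2m+1 p∤c nonres′)
    where
    c⁻¹ w : ℤ
    c⁻¹ = inverse c
    w = d · c⁻¹
    c⁻¹c≈1 : c⁻¹ · c ≈ + 1
    c⁻¹c≈1 = inverse-spec c p∤c
    cw≈d : c · w ≈ d
    cw≈d = begin
      c · (d · c⁻¹)  ≡⟨ rearrange c d c⁻¹ ⟩
      d · (c⁻¹ · c)  ≈⟨ ≈-· (≈-refl {d}) c⁻¹c≈1 ⟩
      d · + 1        ≡⟨ ℤP.*-identityʳ d ⟩
      d              ∎
      where
      open ≈-Reasoning
      rearrange : ∀ c d e → c · (d · e) ≡ d · (e · c)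
      rearrange = solve-∀
    16t≈w² : + 16 · t ≈ w · w
    16t≈w² = begin
        + 16 · t                                ≡⟨ ℤP.*-identityʳ (+ 16 · t) ⟨
        + 16 · t · + 1                          ≈⟨ ≈-· (≈-refl {+ 16 · t}) (≈-sym (≈-· c⁻¹c≈1 c⁻¹c≈1)) ⟩
        + 16 · t · ((c⁻¹ · c) · (c⁻¹ · c))      ≡⟨ rearrange t c c⁻¹ ⟩
        (+ 16 · t · (c · c)) · (c⁻¹ · c⁻¹)      ≈⟨ ≈-· 16tc²≈d² (≈-refl {c⁻¹ · c⁻¹}) ⟩
        (d · d) · (c⁻¹ · c⁻¹)                   ≡⟨ interchange d c⁻¹ ⟩
        (d · c⁻¹) · (d · c⁻¹)                   ∎
      where
      open ≈-Reasoning
      rearrange : ∀ t c e → + 16 · t · ((e · c) · (e · c)) ≡ (+ 16 · t · (c · c)) · (e · e)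
      rearrange = solve-∀
      interchange : ∀ d e → (d · d) · (e · e) ≡ (d · e) · (d · e)
      interchange = solve-∀
    nonres′ : NonResidue ((c + c · w) · (c − c · w))
    nonres′ = nonresidue-≈ (≈-· (≈-+ (≈-refl {c}) cw≈d) (≈-− (≈-refl {c}) cw≈d)) nonres

  -- Reduction of p-integral rationals modulo p: r ↝ t says that t ∈ ℤ
  -- represents r, i.e. p ∤ den r and num r ≡ t · den r.
  infix 4 _↝_
  record _↝_ (r : ℚ) (t : ℤ) : Set where
    constructor represents
    field
      den-unit : ¬ p∣ ↧ r
      num≈     : ↥ r ≈ t · ↧ r

  ↝-/ : ∀ i n .{{_ : ℕ.NonZero n}} t → ¬ p∣ + n → i ≈ t · + n → i ℚ./ n ↝ t
  ↝-/ i n t p∤n (mk≈ d) = represents p∤den (mk≈ (cancel g _ p∤g (p∣-≡ rescale d)))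
    where
    g : ℤ
    g = gcd i (+ n)
    den·g : ↧ (i ℚ./ n) · g ≡ + n
    den·g = ℚP.↧-/ i n
    num·g : ↥ (i ℚ./ n) · g ≡ i
    num·g = ℚP.↥-/ i n
    p∤den : ¬ p∣ ↧ (i ℚ./ n)
    p∤den dd = p∤n (p∣-≡ den·g (p∣-·ʳ g dd))
    p∤g : ¬ p∣ g
    p∤g dg = p∤n (p∣-≡ den·g (p∣-·ˡ (↧ (i ℚ./ n)) dg))
    factorOut : ∀ a b g t → a · g − t · (b · g) ≡ g · (a − t · b)
    factorOut = solve-∀
    rescale : i − t · + n ≡ g · (↥ (i ℚ./ n) − t · ↧ (i ℚ./ n))
    rescale = trans (cong₂ (λ a b → a − t · b) (sym num·g) (sym den·g))
                    (factorOut (↥ (i ℚ./ n)) (↧ (i ℚ./ n)) g t)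

  ↝-ℤ : ∀ i → i ℚ./ 1 ↝ i
  ↝-ℤ i = ↝-/ i 1 i p∤1 (≡⇒≈ (sym (ℤP.*-identityʳ i)))

  ↝-ℕ : ∀ n → ℕ→ℚ n ↝ + n
  ↝-ℕ n = ↝-ℤ (+ n)

  ↝-+ : ∀ {x y t u} → x ↝ t → y ↝ u → x ℚ.+ y ↝ t + u
  ↝-+ {mkℚ a b _} {mkℚ a′ b′ _} {t} {u} (represents p∤X (mk≈ dx)) (represents p∤Y (mk≈ dy)) =
    ↝-/ (a · Y + a′ · X) (suc b ℕ.* suc b′) (t + u)
        (λ d → p∤-· X Y p∤X p∤Y (p∣-≡ (ℤP.pos-* (suc b) (suc b′)) d))
        (mk≈ (p∣-≡ (sym (trans (cong (λ z → a · Y + a′ · X − (t + u) · z) (ℤP.pos-* (suc b) (suc b′)))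
                               (regroup a a′ X Y t u)))
                   (p∣-linear Y (a − t · X) X (a′ − u · Y) refl dx dy)))
    where
    X Y : ℤ
    X = + suc b
    Y = + suc b′
    regroup : ∀ a a′ X Y t u → a · Y + a′ · X − (t + u) · (X · Y) ≡ Y · (a − t · X) + X · (a′ − u · Y)
    regroup = solve-∀

  ↝-* : ∀ {x y t u} → x ↝ t → y ↝ u → x * y ↝ t · u
  ↝-* {mkℚ a b _} {mkℚ a′ b′ _} {t} {u} (represents p∤X (mk≈ dx)) (represents p∤Y (mk≈ dy)) =
    ↝-/ (a · a′) (suc b ℕ.* suc b′) (t · u)
        (λ d → p∤-· X Y p∤X p∤Y (p∣-≡ (ℤP.pos-* (suc b) (suc b′)) d))
        (mk≈ (p∣-≡ (sym (trans (cong (λ z → a · a′ − (t · u) · z) (ℤP.pos-* (suc b) (suc b′)))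
                               (regroup a a′ X Y t u)))
                   (p∣-linear a′ (a − t · X) (t · X) (a′ − u · Y) refl dx dy)))
    where
    X Y : ℤ
    X = + suc b
    Y = + suc b′
    regroup : ∀ a a′ X Y t u → a · a′ − (t · u) · (X · Y) ≡ a′ · (a − t · X) + (t · X) · (a′ − u · Y)
    regroup = solve-∀

  ↝-neg : ∀ {x t} → x ↝ t → ℚ.- x ↝ - t
  ↝-neg {x} {t} (represents p∤den (mk≈ d)) =
    represents (subst (λ z → ¬ p∣ z) (sym (ℚP.↧-neg x)) p∤den)
               (mk≈ (p∣-≡ (sym (trans (cong₂ (λ a b → a − (- t) · b) (ℚP.↥-neg x) (ℚP.↧-neg x))
                                      (negate (↥ x) t (↧ x))))
                          (p∣-neg d)))
    where
    negate : ∀ a t b → - a − (- t) · b ≡ - (a − t · b)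
    negate = solve-∀

  ↝-− : ∀ {x y t u} → x ↝ t → y ↝ u → x - y ↝ t − u
  ↝-− x↝t y↝u = ↝-+ x↝t (↝-neg y↝u)

  ↝-^ : ∀ {x t} k → x ↝ t → x ^ℚ k ↝ t ^ k
  ↝-^ zero    x↝t = ↝-ℕ 1
  ↝-^ (suc k) x↝t = ↝-* x↝t (↝-^ k x↝t)

  ↝-Σ : ∀ n {f : ℕ → ℚ} {g : ℕ → ℤ} → (∀ k → f k ↝ g k) → Σ[0≤k≤ n ] f ↝ Σℤ[0≤k≤ n ] g
  ↝-Σ zero    f↝g = f↝g 0
  ↝-Σ (suc n) f↝g = ↝-+ (↝-Σ n f↝g) (f↝g (suc n))

  ↝-inv : ∀ x .{{_ : ℚ.NonZero x}} {t u} → x ↝ t → ¬ p∣ t → u · t ≈ + 1 → 1/ x ↝ u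
  ↝-inv (mkℚ (+ 0) _ _) {{()}}
  ↝-inv (mkℚ +[1+ n ] d _) {t} {u} (represents p∤den (mk≈ dx)) p∤t (mk≈ dut) =
    represents p∤num (mk≈ (p∣-linear (- Den) (u · t − + 1) (- u) (Num − t · Den) (regroup Num Den t u) dut dx))
    where
    Num Den : ℤ
    Num = + suc n
    Den = + suc d
    p∤num : ¬ p∣ Num
    p∤num dN = p∤-· t Den p∤t p∤den (p∣-≡ (difference Num (t · Den)) (p∣-− dN dx))
      where
      difference : ∀ a b → a − (a − b) ≡ b
      difference = solve-∀
    regroup : ∀ Num Den t u → Den − u · Num ≡ (- Den) · (u · t − + 1) + (- u) · (Num − t · Den)
    regroup = solve-∀
  ↝-inv (mkℚ -[1+ n ] d _) {t} {u} (represents p∤den (mk≈ dx)) p∤t (mk≈ dut) =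
    represents p∤num (mk≈ (p∣-linear Den (u · t − + 1) u (- Num − t · Den) (regroup Num Den t u) dut dx))
    where
    Num Den : ℤ
    Num = + suc n
    Den = + suc d
    p∤num : ¬ p∣ Num
    p∤num dN = p∤-· t Den p∤t p∤den (p∣-≡ (difference Num (t · Den)) (p∣-− (p∣-neg dN) dx))
      where
      difference : ∀ a b → - a − (- a − b) ≡ b
      difference = solve-∀
    regroup : ∀ Num Den t u → - Den − u · Num ≡ Den · (u · t − + 1) + u · (- Num − t · Den)
    regroup = solve-∀

  ↝-recip : ∀ x .{{_ : ℚ.NonZero x}} {t} → x ↝ t → ¬ p∣ t → 1/ x ↝ inverse t
  ↝-recip x {t} x↝t p∤t = ↝-inv x x↝t p∤t (inverse-spec t p∤t)

  ↝-exists : ∀ r → pIntegral p r → Σ ℤ (r ↝_)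
  ↝-exists r p∤den′ = ↥ r · inverse (↧ r) , represents p∤den
    (mk≈ (p∣-≡ (sym (factorOut (↥ r) (inverse (↧ r)) (↧ r))) (p∣-·ˡ (- ↥ r) (fermat-unit (↧ r) p∤den))))
    where
    p∤den : ¬ p∣ ↧ r
    p∤den d = p∤den′ (ℤ∣.∣⇒∣ᵤ d)
    factorOut : ∀ a q d → a − (a · q) · d ≡ (- a) · (d · q − + 1)
    factorOut = solve-∀

  -- As p ∤ den r, p divides num r exactly when it divides a representative.
  ↝-divides : ∀ {r t} → r ↝ t → p∣ ↥ r → p∣ t
  ↝-divides {r} {t} (represents p∤den (mk≈ d)) p∣num =
    [ id , (λ p∣den → ⊥-elim (p∤den p∣den)) ]′
      (euclid t (↧ r) (p∣-≡ (difference (↥ r) t (↧ r)) (p∣-− p∣num d)))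
    where
    difference : ∀ a s b → a − (a − s · b) ≡ s · b
    difference = solve-∀

  divides-↝ : ∀ {r t} → r ↝ t → p∣ t → p∣ ↥ r
  divides-↝ {r} {t} (represents _ (mk≈ d)) p∣t =
    p∣-linear (+ 1) (↥ r − t · ↧ r) (↧ r) t (regroup (↥ r) t (↧ r)) d p∣t
    where
    regroup : ∀ a s b → a ≡ + 1 · (a − s · b) + b · s
    regroup = solve-∀

  congruence⇒≈ : ∀ {a b t u} → a ↝ t → b ↝ u → a ≡ b [mod p ] → t ≈ u
  congruence⇒≈ a↝t b↝u a≡b = mk≈ (↝-divides (↝-− a↝t b↝u) (ℤ∣.∣ᵤ⇒∣ a≡b))

  ≈⇒congruence : ∀ {a b t u} → a ↝ t → b ↝ u → t ≈ u → a ≡ b [mod p ]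
  ≈⇒congruence a↝t b↝u (mk≈ d) = ℤ∣.∣⇒∣ᵤ (divides-↝ (↝-− a↝t b↝u) d)

  m : ℕ
  m = p / 4

  2m≤h : m ℕ.+ m ℕ.≤ h
  2m≤h = proj₁ (quarter-bounds h)

  h≤2m+1 : h ℕ.≤ suc (m ℕ.+ m)
  h≤2m+1 = proj₂ (quarter-bounds h)

  ↝-∤ : ∀ {r t} → r ↝ t → p ∤ℚ r → ¬ p∣ t
  ↝-∤ {t = t} r↝t p∤r p∣t = p∤r (≈⇒congruence r↝t (↝-ℕ 0) (mk≈ (p∣-≡ (sym (ℤP.+-identityʳ t)) p∣t)))

  ↝-square : ∀ {r a} → r ↝ a → LegendreOne r p → Σ ℤ λ q → a ≈ q · q
  ↝-square r↝a (_ , q , r≡q²) = q , congruence⇒≈ r↝a (↝-ℤ (q · q)) r≡q²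

  ↝-nonresidue : ∀ {r a} → r ↝ a → LegendreMinusOne r p → NonResidue a
  ↝-nonresidue r↝a (_ , notSquare) (s , a≈s²) = notSquare (s , ≈⇒congruence r↝a (↝-ℤ (s · s)) a≈s²)

  ↝-binomSum : ∀ n {x t} → x ↝ t → binomSum n x ↝ binomSumℤ n t
  ↝-binomSum n x↝t = ↝-Σ n (λ k → ↝-* (↝-ℕ ((4 ℕ.* k) C (2 ℕ.* k))) (↝-^ k x↝t))

  binomSum-vanishes : ∀ n {x t} → x ↝ t → p∣ binomSumℤ n t → binomSum n x ≡ ℕ→ℚ 0 [mod p ]
  binomSum-vanishes n {t = t} x↝t d =
    ≈⇒congruence (↝-binomSum n x↝t) (↝-ℕ 0) (mk≈ (p∣-≡ (sym (ℤP.+-identityʳ (binomSumℤ n t))) d))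

  -- Part (i): t represents P²/(64Q) and c = 2q, d = π satisfy 16 t c² ≡ d²,
  -- while (c+d)(c-d) ≡ 4Q - P² is a non-residue.
  part-i : ∀ P Q .{{_ : ℚ.NonZero Q}} {π κ q} → P ↝ π → Q ↝ κ → ¬ p∣ κ → κ ≈ q · q →
    LegendreMinusOne (ℕ→ℚ 4 * Q - P * P) p →
    binomSum m (P * P * (1/ Q) * (1/ ℕ→ℚ 64)) ≡ ℕ→ℚ 0 [mod p ]
  part-i P Q {π} {κ} {q} P↝π Q↝κ p∤κ κ≈q² legendre =
    binomSum-vanishes m x↝t (keyCongruence m 2m≤h h≤2m+1 t (+ 2 · q) π p∤2q 16tc²≈d² nonres)
    where
    κ⁻¹ 64⁻¹ t : ℤ
    κ⁻¹ = inverse κ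
    64⁻¹ = inverse (+ 64)
    t = π · π · κ⁻¹ · 64⁻¹
    p∤64 : ¬ p∣ + 64
    p∤64 = p∤-^ (+ 2) 6 p∤2
    x↝t : P * P * (1/ Q) * (1/ ℕ→ℚ 64) ↝ t
    x↝t = ↝-* (↝-* (↝-* P↝π P↝π) (↝-recip Q Q↝κ p∤κ)) (↝-recip (ℕ→ℚ 64) (↝-ℕ 64) p∤64)
    p∤2q : ¬ p∣ (+ 2 · q)
    p∤2q = p∤-· (+ 2) q p∤2 (λ p∣q → p∤κ (p∣-≈ κ≈q² (p∣-·ʳ q p∣q)))
    16tc²≈d² : + 16 · t · ((+ 2 · q) · (+ 2 · q)) ≈ π · π
    16tc²≈d² = begin
        + 16 · t · ((+ 2 · q) · (+ 2 · q))
      ≡⟨ regroup π q κ⁻¹ 64⁻¹ ⟩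
        π · π · (κ⁻¹ · (q · q)) · (64⁻¹ · + 64)
      ≈⟨ ≈-· (≈-· (≈-refl {π · π}) (≈-· (≈-refl {κ⁻¹}) (≈-sym κ≈q²))) (inverse-spec (+ 64) p∤64) ⟩
        π · π · (κ⁻¹ · κ) · + 1
      ≈⟨ ≈-· (≈-· (≈-refl {π · π}) (inverse-spec κ p∤κ)) (≈-refl {+ 1}) ⟩
        π · π · + 1 · + 1
      ≡⟨ unit π ⟩
        π · π
      ∎
      where
      open ≈-Reasoning
      regroup : ∀ π q a b → + 16 · (π · π · a · b) · ((+ 2 · q) · (+ 2 · q)) ≡ π · π · (a · (q · q)) · (b · + 64)
      regroup = solve-∀
      unit : ∀ π → π · π · + 1 · + 1 ≡ π · π
      unit = solve-∀
    nonres : NonResidue ((+ 2 · q + π) · (+ 2 · q − π))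
    nonres = nonresidue-≈ (begin
        (+ 2 · q + π) · (+ 2 · q − π)   ≡⟨ differenceOfSquares q π ⟩
        + 4 · (q · q) − π · π           ≈⟨ ≈-− (≈-· (≈-refl {+ 4}) (≈-sym κ≈q²)) (≈-refl {π · π}) ⟩
        + 4 · κ − π · π                 ∎)
      (↝-nonresidue (↝-− (↝-* (↝-ℕ 4) Q↝κ) (↝-* P↝π P↝π)) legendre)
      where
      open ≈-Reasoning
      differenceOfSquares : ∀ q π → (+ 2 · q + π) · (+ 2 · q − π) ≡ + 4 · (q · q) − π · π
      differenceOfSquares = solve-∀

  -- Part (ii): t represents Q/(4P²) and c = π, d = 2q satisfy 16 t c² ≡ d²,
  -- while (c+d)(c-d) ≡ P² - 4Q is a non-residue.
  part-ii : ∀ P Q .{{_ : ℚ.NonZero P}} {π κ q} → P ↝ π → Q ↝ κ → ¬ p∣ π → κ ≈ q · q →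
    LegendreMinusOne (P * P - ℕ→ℚ 4 * Q) p →
    binomSum m (Q * (1/ P) * (1/ P) * (1/ ℕ→ℚ 4)) ≡ ℕ→ℚ 0 [mod p ]
  part-ii P Q {π} {κ} {q} P↝π Q↝κ p∤π κ≈q² legendre =
    binomSum-vanishes m x↝t (keyCongruence m 2m≤h h≤2m+1 t π (+ 2 · q) p∤π 16tc²≈d² nonres)
    where
    π⁻¹ 4⁻¹ t : ℤ
    π⁻¹ = inverse π
    4⁻¹ = inverse (+ 4)
    t = κ · π⁻¹ · π⁻¹ · 4⁻¹
    p∤4 : ¬ p∣ + 4
    p∤4 = p∤-^ (+ 2) 2 p∤2
    P⁻¹↝π⁻¹ : 1/ P ↝ π⁻¹
    P⁻¹↝π⁻¹ = ↝-recip P P↝π p∤π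
    x↝t : Q * (1/ P) * (1/ P) * (1/ ℕ→ℚ 4) ↝ t
    x↝t = ↝-* (↝-* (↝-* Q↝κ P⁻¹↝π⁻¹) P⁻¹↝π⁻¹) (↝-recip (ℕ→ℚ 4) (↝-ℕ 4) p∤4)
    16tc²≈d² : + 16 · t · (π · π) ≈ (+ 2 · q) · (+ 2 · q)
    16tc²≈d² = begin
        + 16 · t · (π · π)
      ≡⟨ regroup π κ π⁻¹ 4⁻¹ ⟩
        + 4 · κ · ((π⁻¹ · π) · (π⁻¹ · π)) · (4⁻¹ · + 4)
      ≈⟨ ≈-· (≈-· (≈-refl {+ 4 · κ}) (≈-· (inverse-spec π p∤π) (inverse-spec π p∤π))) (inverse-spec (+ 4) p∤4) ⟩
        + 4 · κ · (+ 1 · + 1) · + 1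
      ≡⟨ unit κ ⟩
        + 4 · κ
      ≈⟨ ≈-· (≈-refl {+ 4}) κ≈q² ⟩
        + 4 · (q · q)
      ≡⟨ double q ⟩
        (+ 2 · q) · (+ 2 · q)
      ∎
      where
      open ≈-Reasoning
      regroup : ∀ π κ a b → + 16 · (κ · a · a · b) · (π · π) ≡ + 4 · κ · ((a · π) · (a · π)) · (b · + 4)
      regroup = solve-∀
      unit : ∀ κ → + 4 · κ · (+ 1 · + 1) · + 1 ≡ + 4 · κ
      unit = solve-∀
      double : ∀ q → + 4 · (q · q) ≡ (+ 2 · q) · (+ 2 · q)
      double = solve-∀
    nonres : NonResidue ((π + + 2 · q) · (π − + 2 · q))
    nonres = nonresidue-≈ (begin
        (π + + 2 · q) · (π − + 2 · q)   ≡⟨ differenceOfSquares q π ⟩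
        π · π − + 4 · (q · q)           ≈⟨ ≈-− (≈-refl {π · π}) (≈-· (≈-refl {+ 4}) (≈-sym κ≈q²)) ⟩
        π · π − + 4 · κ                 ∎)
      (↝-nonresidue (↝-− (↝-* P↝π P↝π) (↝-* (↝-ℕ 4) Q↝κ)) legendre)
      where
      open ≈-Reasoning
      differenceOfSquares : ∀ q π → (π + + 2 · q) · (π − + 2 · q) ≡ π · π − + 4 · (q · q)
      differenceOfSquares = solve-∀

  theorem : (P Q : ℚ) → .{{_ : ℚ.NonZero P}} → .{{_ : ℚ.NonZero Q}} →
    pIntegral p P → pIntegral p Q →
    p ∤ℚ (P * Q * (P * P - ℕ→ℚ 4 * Q)) →
    LegendreOne Q p →
    (LegendreMinusOne (ℕ→ℚ 4 * Q - P * P) p →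
      binomSum (p / 4) (P * P * (1/ Q) * (1/ ℕ→ℚ 64)) ≡ ℕ→ℚ 0 [mod p ])
    × (LegendreMinusOne (P * P - ℕ→ℚ 4 * Q) p →
      binomSum (p / 4) (Q * (1/ P) * (1/ P) * (1/ ℕ→ℚ 4)) ≡ ℕ→ℚ 0 [mod p ])
  theorem P Q P-integral Q-integral p∤PQΔ Q-square =
    part-i P Q {q = q} P↝π Q↝κ p∤κ κ≈q² , part-ii P Q {q = q} P↝π Q↝κ p∤π κ≈q²
    where
    π κ q : ℤ
    π = proj₁ (↝-exists P P-integral)
    κ = proj₁ (↝-exists Q Q-integral)
    P↝π : P ↝ π
    P↝π = proj₂ (↝-exists P P-integral)
    Q↝κ : Q ↝ κ
    Q↝κ = proj₂ (↝-exists Q Q-integral)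
    q = proj₁ (↝-square Q↝κ Q-square)
    κ≈q² : κ ≈ q · q
    κ≈q² = proj₂ (↝-square Q↝κ Q-square)
    p∤πκΔ : ¬ p∣ (π · κ · (π · π − + 4 · κ))
    p∤πκΔ = ↝-∤ (↝-* (↝-* P↝π Q↝κ) (↝-− (↝-* P↝π P↝π) (↝-* (↝-ℕ 4) Q↝κ))) p∤PQΔ
    p∤π : ¬ p∣ π
    p∤π d = p∤πκΔ (p∣-·ʳ (π · π − + 4 · κ) (p∣-·ʳ κ d))
    p∤κ : ¬ p∣ κ
    p∤κ d = p∤πκΔ (p∣-·ʳ (π · π − + 4 · κ) (p∣-·ˡ π d))

theorem2p3 : (p : ℕ) → Prime p → ¬ (2 ∣ p) →
    (P Q : ℚ) → .{{_ : ℚ.NonZero P}} → .{{_ : ℚ.NonZero Q}} →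
    pIntegral p P → pIntegral p Q →
    p ∤ℚ (P * Q * (P * P - ℕ→ℚ 4 * Q)) →
    LegendreOne Q p →
    (LegendreMinusOne (ℕ→ℚ 4 * Q - P * P) p →
      binomSum (p / 4) (P * P * (1/ Q) * (1/ ℕ→ℚ 64)) ≡ ℕ→ℚ 0 [mod p ])
    × (LegendreMinusOne (P * P - ℕ→ℚ 4 * Q) p →
      binomSum (p / 4) (Q * (1/ P) * (1/ P) * (1/ ℕ→ℚ 4)) ≡ ℕ→ℚ 0 [mod p ])
theorem2p3 p p-prime p-odd with oddPrime-form p p-prime p-odd
... | h′ , refl = OddPrime.theorem h′ p-prime
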